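{- Let $1\le s\le t\le r$ be integers with $r\le 3t-2s$. Then \[ R_s(r,t)=\left\lfloor\frac{r-t}{2}\right\rfloor + s. \]
   Context: All hypergraphs are finite. An $r$-uniform hypergraph $\mathcal H$ is $r$-partite if its vertex set can be partitioned as $V(\mathcal H)=P_1\sqcup\dots\sqcup P_r$ such that $|e\cap P_j|=1$ for every edge $e$ and every $j\in[r]$. It is $t$-intersecting if $|e\cap f|\ge t$ for all $e,f\in E(\mathcal H)$. An $(r,t)$-graph is an $r$-uniform, $r$-partite, $t$-intersecting hypergraph. For $s\ge1$, an $s$-cover of $\mathcal H$ is a set $B\subseteq V(\mathcal H)$ with $|B\cap e|\ge s$ for every edge $e$, and $\tau_s(\mathcal H)$ is the minimum size of an $s$-cover. For $1\le s\le t\le r$, $R_s(r,t)$ is the maximum of $\tau_s(\mathcal H)$ over all $(r,t)$-graphs $\mathcal H$. -}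

module Defs where

open import Data.Nat using (ℕ; _≤_; _≥_; _≡ᵇ_)
open import Data.Fin using (Fin)
open import Data.Fin.Subset using (Subset; _∩_; ∣_∣; inside; outside)
open import Data.Fin.Properties using (_≟_)
open import Data.Vec using (tabulate)
open import Data.List using (List)
open import Data.List.Membership.Propositional using (_∈_)
open import Data.Product using (Σ; ∃; _×_)
open import Data.Bool using (if_then_else_)
open import Relation.Nullary.Decidable using (⌊_⌋)
open import Relation.Binary.PropositionalEquality using (_≡_)

record Hypergraph : Set where
  constructor hypergraph
  field
    n     : ℕ
    edges : List (Subset n)
open Hypergraph public

-- the class P_j of a partition given by a labelling  part : Fin n → Fin r
class : ∀ {n r} → (Fin n → Fin r) → Fin r → Subset n
class part j = tabulate (λ v → if ⌊ part v ≟ j ⌋ then inside else outside)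

Uniform : ℕ → Hypergraph → Set
Uniform r H = ∀ e → e ∈ edges H → ∣ e ∣ ≡ r

Partite : ℕ → Hypergraph → Set
Partite r H = Σ (Fin (n H) → Fin r) λ part →
  ∀ e → e ∈ edges H → ∀ j → ∣ e ∩ class part j ∣ ≡ 1

Intersecting : ℕ → Hypergraph → Set
Intersecting t H = ∀ e f → e ∈ edges H → f ∈ edges H → ∣ e ∩ f ∣ ≥ t

RTGraph : ℕ → ℕ → Hypergraph → Set
RTGraph r t H = Uniform r H × Partite r H × Intersecting t H

IsCover : (s : ℕ) (H : Hypergraph) → Subset (n H) → Set
IsCover s H B = ∀ e → e ∈ edges H → ∣ B ∩ e ∣ ≥ s

CoverNumber : ℕ → Hypergraph → ℕ → Set
CoverNumber s H k =
  (Σ (Subset (n H)) λ B → IsCover s H B × ∣ B ∣ ≡ k) ×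
  (∀ B → IsCover s H B → k ≤ ∣ B ∣)

IsRs : ℕ → ℕ → ℕ → ℕ → Set
IsRs s r t m =
  (∃ λ H → RTGraph r t H × CoverNumber s H m) ×
  (∀ H k → RTGraph r t H → CoverNumber s H k → k ≤ m)

module Submission where

-- Upper bound.  The edges of an r-partite r-uniform hypergraph are transversals of its r
-- classes, and counting class by class shows that any three edges satisfy
--     |e ∩ f| + |e ∩ g| + |f ∩ g| ≤ 2 |e ∩ f ∩ g| + r.
-- Let e, f be edges with c = |e ∩ f| smallest.  Then every edge g has |e ∩ f ∩ g| ≥ (3c - r)/2,
-- so keeping ⌊(r - c)/2⌋ + s vertices of e ∩ f (which fit, as r + 2s ≤ 3t ≤ 3c) leaves at
-- least s of them in every edge: an s-cover with at most ⌊(r - t)/2⌋ + s vertices.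
--
-- Lower bound.  With d = ⌊(r - t)/2⌋ and q = d + s, take the vertices (i , a), i < r, a ≤ q,
-- and as edges the graphs of all vectors x ∈ {0..q}^r with at most d nonzero entries.  Two
-- edges share at least r - 2d ≥ t vertices, the q vertices (i , 0) with i < q form an s-cover,
-- and any smaller set B misses all but at most |B| - d vertices of a suitable edge; so τ_s = q.

open import Defs
open import Data.Nat using (ℕ; zero; suc; _≤_; _<_; _+_; _*_; _∸_; z≤n; s≤s; s≤s⁻¹; _≤ᵇ_; _<ᵇ_)
open import Data.Nat.Properties
  using (+-mono-≤; +-monoˡ-≤; +-monoʳ-≤; +-cancelˡ-≤; +-cancelʳ-≤; +-identityʳ; +-assoc; +-comm; +-suc;
         *-comm; *-monoˡ-≤; *-monoʳ-≤; ∸-monoˡ-≤; ∸-monoʳ-≤; m∸n+n≡m; m∸n≢0⇒n<m; m≤o∸n⇒m+n≤o;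
         m≤m+n; m≤n+m; n≤1+n; ≤-refl; ≤-reflexive; ≤-trans; <⇒≤; <-irrefl; ≰⇒>; _≤?_; ≤ᵇ⇒≤;
         +-0-commutativeMonoid; module ≤-Reasoning)
open import Data.Nat.DivMod using (_/_; _%_; m/n≤m; m/n*n≤m; m≡m%n+[m/n]*n; m%n<n; /-monoˡ-≤)
open import Data.Nat.Tactic.RingSolver using (solve-∀)
open import Data.Bool using (Bool; true; false; _∧_; _∨_; not; T; if_then_else_)
open import Data.Bool.Properties using (∧-identityʳ; ∧-zeroʳ)
open import Data.Fin using (Fin; zero; suc; toℕ; combine; quotient; remainder; _↑ˡ_; _↑ʳ_)
open import Data.Fin.Properties using (_≟_; suc-injective; remQuot-combine)
open import Data.Fin.Subset using (Subset; _∩_; ∣_∣; inside; outside; ⊥)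
open import Data.Fin.Subset.Properties using (∣⊥∣≡0; ∣p∩q∣≤∣p∣; ∩-comm)
open import Data.Vec using (Vec; []; _∷_; lookup; tabulate)
open import Data.Vec.Properties using (lookup-zipWith; lookup∘tabulate)
open import Data.List using (List; []; _∷_; cartesianProduct; cartesianProductWith; allFin; filter; map)
open import Data.List.Membership.Propositional using (_∈_)
open import Data.List.Membership.Propositional.Properties
  using (∈-cartesianProduct⁺; ∈-cartesianProduct⁻; ∈-cartesianProductWith⁺; ∈-allFin;
         ∈-filter⁺; ∈-filter⁻; ∈-map⁺; ∈-map⁻)
open import Data.List.Relation.Unary.Any using (here)
import Data.List.Relation.Unary.All as All
open import Data.List.Extrema.Nat using (argmin; argmin-sel; f[argmin]≤f[xs])
open import Data.Product using (Σ; ∃; ∃₂; _×_; _,_; proj₁; proj₂)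
open import Data.Sum using (inj₁; inj₂)
open import Relation.Nullary.Decidable using (Dec; ⌊_⌋; yes; no; dec-true; dec-false; isYes≗does)
open import Relation.Binary.PropositionalEquality
open import Algebra.Properties.CommutativeMonoid.Sum +-0-commutativeMonoid
  using (sum; sum-cong-≗; ∑-distrib-+; ∑-comm; sum-replicate-zero)

𝟙 : Bool → ℕ
𝟙 true  = 1
𝟙 false = 0

count : ∀ {n} → (Fin n → Bool) → ℕ
count h = sum (λ v → 𝟙 (h v))

∣∣≡count : ∀ {n} (X : Subset n) → ∣ X ∣ ≡ count (lookup X)
∣∣≡count []          = refl
∣∣≡count (true ∷ X)  = cong suc (∣∣≡count X)
∣∣≡count (false ∷ X) = ∣∣≡count X

∣∩∣≡count : ∀ {n} (X Y : Subset n) → ∣ X ∩ Y ∣ ≡ count (λ v → lookup X v ∧ lookup Y v)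
∣∩∣≡count X Y = trans (∣∣≡count (X ∩ Y)) (sum-cong-≗ (λ v → cong 𝟙 (lookup-zipWith _∧_ v X Y)))

∑-mono-≤ : ∀ {n} {f g : Fin n → ℕ} → (∀ i → f i ≤ g i) → sum f ≤ sum g
∑-mono-≤ {zero}  f≤g = z≤n
∑-mono-≤ {suc n} f≤g = +-mono-≤ (f≤g zero) (∑-mono-≤ (λ i → f≤g (suc i)))

∑-ones : ∀ n → sum {n} (λ _ → 1) ≡ n
∑-ones zero    = refl
∑-ones (suc n) = cong suc (∑-ones n)

term≤∑ : ∀ {n} (f : Fin n → ℕ) i → f i ≤ sum f
term≤∑ f zero    = m≤m+n (f zero) _
term≤∑ f (suc i) = ≤-trans (term≤∑ (λ j → f (suc j)) i) (m≤n+m _ (f zero))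

∑-distrib-+₃ : ∀ {n} (f g h : Fin n → ℕ) → sum (λ i → f i + g i + h i) ≡ sum f + sum g + sum h
∑-distrib-+₃ f g h = trans (∑-distrib-+ (λ i → f i + g i) h) (cong (_+ sum h) (∑-distrib-+ f g))

∑-single : ∀ {n} (f : Fin n → ℕ) k → (∀ i → i ≢ k → f i ≡ 0) → sum f ≡ f k
∑-single {suc n} f zero vanish = begin
    f zero + sum (λ i → f (suc i))
  ≡⟨ cong (f zero +_) (sum-cong-≗ (λ i → vanish (suc i) (λ ()))) ⟩
    f zero + sum {n} (λ _ → 0)
  ≡⟨ cong (f zero +_) (sum-replicate-zero n) ⟩
    f zero + 0
  ≡⟨ +-identityʳ (f zero) ⟩
    f zero ∎
  where open ≡-Reasoning
∑-single {suc n} f (suc k) vanish =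
  cong₂ _+_ (vanish zero (λ ())) (∑-single (λ i → f (suc i)) k vanish-tail)
  where
    vanish-tail : ∀ i → i ≢ k → f (suc i) ≡ 0
    vanish-tail i i≢k = vanish (suc i) (λ i+1≡k+1 → i≢k (suc-injective i+1≡k+1))

∑-combine : ∀ r m (f : Fin (r * m) → ℕ) → sum f ≡ sum (λ i → sum (λ a → f (combine {r} {m} i a)))
∑-combine zero    m f = refl
∑-combine (suc r) m f = trans (∑-split m (r * m) f) (cong (sum (λ a → f (a ↑ˡ r * m)) +_) (∑-combine r m (λ b → f (m ↑ʳ b))))
  where
    ∑-split : ∀ m k (g : Fin (m + k) → ℕ) → sum g ≡ sum (λ a → g (a ↑ˡ k)) + sum (λ b → g (m ↑ʳ b))
    ∑-split zero    k g = refl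
    ∑-split (suc m) k g = trans (cong (g zero +_) (∑-split m k (λ i → g (suc i)))) (sym (+-assoc (g zero) _ _))

≟-refl : ∀ {n} (i : Fin n) → ⌊ i ≟ i ⌋ ≡ true
≟-refl i = trans (isYes≗does (i ≟ i)) (dec-true (i ≟ i) refl)

≟-≢ : ∀ {n} {i j : Fin n} → i ≢ j → ⌊ i ≟ j ⌋ ≡ false
≟-≢ {i = i} {j} i≢j = trans (isYes≗does (i ≟ j)) (dec-false (i ≟ j) i≢j)

lookup-class : ∀ {n r} (part : Fin n → Fin r) j v → lookup (class part j) v ≡ ⌊ part v ≟ j ⌋
lookup-class part j v rewrite lookup∘tabulate (λ w → if ⌊ part w ≟ j ⌋ then inside else outside) v
  with part v ≟ j
... | yes _ = refl
... | no  _ = refl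

count-by-class : ∀ {n r} (part : Fin n → Fin r) (h : Fin n → Bool) →
  count h ≡ sum (λ j → count (λ v → h v ∧ lookup (class part j) v))
count-by-class part h = trans (sum-cong-≗ in-own-class) (∑-comm (λ v j → 𝟙 (h v ∧ lookup (class part j) v)))
  where
    -- a vertex is counted once, in the class of its own label
    other-class : ∀ v j → j ≢ part v → 𝟙 (h v ∧ lookup (class part j) v) ≡ 0
    other-class v j j≢pv rewrite lookup-class part j v | ≟-≢ (λ pv≡j → j≢pv (sym pv≡j)) | ∧-zeroʳ (h v) = refl

    in-own-class : ∀ v → 𝟙 (h v) ≡ sum (λ j → 𝟙 (h v ∧ lookup (class part j) v))
    in-own-class v rewrite ∑-single _ (part v) (other-class v) | lookup-class part (part v) v
      | ≟-refl (part v) | ∧-identityʳ (h v) = refl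

Transversal : ∀ {n r} → (Fin n → Fin r) → Subset n → Set
Transversal part e = ∀ j → ∣ e ∩ class part j ∣ ≡ 1

transversal-size : ∀ {n r} (part : Fin n → Fin r) e → Transversal part e → ∣ e ∣ ≡ r
transversal-size {r = r} part e tr = begin
    ∣ e ∣
  ≡⟨ ∣∣≡count e ⟩
    count (lookup e)
  ≡⟨ count-by-class part (lookup e) ⟩
    sum (λ j → count (λ v → lookup e v ∧ lookup (class part j) v))
  ≡⟨ sum-cong-≗ (λ j → trans (sym (∣∩∣≡count e (class part j))) (tr j)) ⟩
    sum {r} (λ _ → 1)
  ≡⟨ ∑-ones r ⟩
    r ∎
  where open ≡-Reasoning

majority : Bool → Bool → Bool → Bool
majority x y z = (x ∧ y) ∨ (x ∧ z) ∨ (y ∧ z)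

-- Pointwise form of  |e∩f| + |e∩g| + |f∩g| = 2|e∩f∩g| + |majority(e,f,g)|.
pairs-vs-triple : ∀ x y z →
  𝟙 (x ∧ y) + 𝟙 (x ∧ z) + 𝟙 (y ∧ z) ≡ (𝟙 ((x ∧ y) ∧ z) + 𝟙 ((x ∧ y) ∧ z)) + 𝟙 (majority x y z)
pairs-vs-triple true  true  true  = refl
pairs-vs-triple true  true  false = refl
pairs-vs-triple true  false true  = refl
pairs-vs-triple true  false false = refl
pairs-vs-triple false true  true  = refl
pairs-vs-triple false true  false = refl
pairs-vs-triple false false true  = refl
pairs-vs-triple false false false = refl

majority-twice : ∀ x y z c → 𝟙 (majority x y z ∧ c) + 𝟙 (majority x y z ∧ c) ≤ 𝟙 (x ∧ c) + 𝟙 (y ∧ c) + 𝟙 (z ∧ c)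
majority-twice x y z false rewrite ∧-zeroʳ (majority x y z) | ∧-zeroʳ x | ∧-zeroʳ y | ∧-zeroʳ z = z≤n
majority-twice x y z true rewrite ∧-identityʳ (majority x y z) | ∧-identityʳ x | ∧-identityʳ y | ∧-identityʳ z =
  ≤ᵇ⇒≤ _ _ (cases x y z)
  where
    cases : ∀ x y z → T (𝟙 (majority x y z) + 𝟙 (majority x y z) ≤ᵇ 𝟙 x + 𝟙 y + 𝟙 z)
    cases true  true  true  = _
    cases true  true  false = _
    cases true  false true  = _
    cases true  false false = _
    cases false true  true  = _
    cases false true  false = _
    cases false false true  = _
    cases false false false = _

double≤3⇒≤1 : ∀ x → x + x ≤ 3 → x ≤ 1
double≤3⇒≤1 zero          _ = z≤n
double≤3⇒≤1 (suc zero)    _ = s≤s z≤n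
double≤3⇒≤1 (suc (suc x)) 2x+4≤3 with s≤s (s≤s (s≤s ())) ← ≤-trans (+-mono-≤ (m≤m+n 2 x) (m≤m+n 2 x)) 2x+4≤3

-- Three transversals meet every class in at most one vertex lying in two of them,
-- so their majority set has at most r vertices.
majority-size : ∀ {n r} (part : Fin n → Fin r) e f g →
  Transversal part e → Transversal part f → Transversal part g →
  count (λ v → majority (lookup e v) (lookup f v) (lookup g v)) ≤ r
majority-size {r = r} part e f g tr-e tr-f tr-g = begin
    count M
  ≡⟨ count-by-class part M ⟩
    sum (λ j → count (λ v → M v ∧ P j v))
  ≤⟨ ∑-mono-≤ (λ j → double≤3⇒≤1 _ (twice≤3 j)) ⟩
    sum {r} (λ _ → 1)
  ≡⟨ ∑-ones r ⟩
    r ∎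
  where
    open ≤-Reasoning
    M : Fin _ → Bool
    M v = majority (lookup e v) (lookup f v) (lookup g v)
    P : Fin _ → Fin _ → Bool
    P j = lookup (class part j)
    twice≤3 : ∀ j → count (λ v → M v ∧ P j v) + count (λ v → M v ∧ P j v) ≤ 3
    twice≤3 j = begin
        count (λ v → M v ∧ P j v) + count (λ v → M v ∧ P j v)
      ≡⟨ ∑-distrib-+ (λ v → 𝟙 (M v ∧ P j v)) (λ v → 𝟙 (M v ∧ P j v)) ⟨
        sum (λ v → 𝟙 (M v ∧ P j v) + 𝟙 (M v ∧ P j v))
      ≤⟨ ∑-mono-≤ (λ v → majority-twice (lookup e v) (lookup f v) (lookup g v) (P j v)) ⟩
        sum (λ v → 𝟙 (lookup e v ∧ P j v) + 𝟙 (lookup f v ∧ P j v) + 𝟙 (lookup g v ∧ P j v))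
      ≡⟨ ∑-distrib-+₃ (λ v → 𝟙 (lookup e v ∧ P j v)) (λ v → 𝟙 (lookup f v ∧ P j v)) (λ v → 𝟙 (lookup g v ∧ P j v)) ⟩
        count (λ v → lookup e v ∧ P j v) + count (λ v → lookup f v ∧ P j v) + count (λ v → lookup g v ∧ P j v)
      ≡⟨ cong₂ _+_ (cong₂ _+_ (∣∩∣≡count e (class part j)) (∣∩∣≡count f (class part j))) (∣∩∣≡count g (class part j)) ⟨
        ∣ e ∩ class part j ∣ + ∣ f ∩ class part j ∣ + ∣ g ∩ class part j ∣
      ≡⟨ cong₂ _+_ (cong₂ _+_ (tr-e j) (tr-f j)) (tr-g j) ⟩
        3 ∎

three-transversals : ∀ {n r} (part : Fin n → Fin r) e f g →
  Transversal part e → Transversal part f → Transversal part g →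
  ∣ e ∩ f ∣ + ∣ e ∩ g ∣ + ∣ f ∩ g ∣ ≤ (∣ (e ∩ f) ∩ g ∣ + ∣ (e ∩ f) ∩ g ∣) + r
three-transversals {r = r} part e f g tr-e tr-f tr-g = begin
    ∣ e ∩ f ∣ + ∣ e ∩ g ∣ + ∣ f ∩ g ∣
  ≡⟨ cong₂ _+_ (cong₂ _+_ (∣∩∣≡count e f) (∣∩∣≡count e g)) (∣∩∣≡count f g) ⟩
    count (λ v → E v ∧ F v) + count (λ v → E v ∧ G v) + count (λ v → F v ∧ G v)
  ≡⟨ ∑-distrib-+₃ (λ v → 𝟙 (E v ∧ F v)) (λ v → 𝟙 (E v ∧ G v)) (λ v → 𝟙 (F v ∧ G v)) ⟨
    sum (λ v → 𝟙 (E v ∧ F v) + 𝟙 (E v ∧ G v) + 𝟙 (F v ∧ G v))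
  ≡⟨ sum-cong-≗ (λ v → pairs-vs-triple (E v) (F v) (G v)) ⟩
    sum (λ v → (Triple v + Triple v) + 𝟙 (majority (E v) (F v) (G v)))
  ≡⟨ ∑-distrib-+ (λ v → Triple v + Triple v) (λ v → 𝟙 (majority (E v) (F v) (G v))) ⟩
    sum (λ v → Triple v + Triple v) + count (λ v → majority (E v) (F v) (G v))
  ≤⟨ +-monoʳ-≤ (sum (λ v → Triple v + Triple v)) (majority-size part e f g tr-e tr-f tr-g) ⟩
    sum (λ v → Triple v + Triple v) + r
  ≡⟨ cong (_+ r) (∑-distrib-+ Triple Triple) ⟩
    (sum Triple + sum Triple) + r
  ≡⟨ cong (λ k → (k + k) + r) triple-count ⟨
    (∣ (e ∩ f) ∩ g ∣ + ∣ (e ∩ f) ∩ g ∣) + r ∎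
  where
    open ≤-Reasoning
    E F G : Fin _ → Bool
    E = lookup e
    F = lookup f
    G = lookup g
    Triple : Fin _ → ℕ
    Triple v = 𝟙 ((E v ∧ F v) ∧ G v)
    triple-count : ∣ (e ∩ f) ∩ g ∣ ≡ sum Triple
    triple-count = trans (∣∩∣≡count (e ∩ f) g)
      (sum-cong-≗ (λ v → cong (λ b → 𝟙 (b ∧ G v)) (lookup-zipWith _∧_ v e f)))

shrink : ∀ {n} (C : Subset n) b → b ≤ ∣ C ∣ →
  Σ (Subset n) λ B → ∣ B ∣ ≡ b × (∀ g → ∣ C ∩ g ∣ + b ≤ ∣ B ∩ g ∣ + ∣ C ∣)
shrink []          zero    z≤n = [] , refl , λ { [] → z≤n }
shrink (false ∷ C) b       b≤C with B , ∣B∣≡b , loss ← shrink C b b≤C =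
  false ∷ B , ∣B∣≡b , λ { (_ ∷ g) → loss g }
shrink (true ∷ C)  zero    _   with B , ∣B∣≡0 , loss ← shrink C zero z≤n =
  false ∷ B , ∣B∣≡0 , λ { (true ∷ g)  → ≤-trans (s≤s (loss g)) (≤-reflexive (sym (+-suc _ _)))
                       ; (false ∷ g) → ≤-trans (loss g) (+-monoʳ-≤ _ (n≤1+n _)) }
shrink (true ∷ C)  (suc b) (s≤s b≤C) with B , ∣B∣≡b , loss ← shrink C b b≤C =
  true ∷ B , cong suc ∣B∣≡b , λ { (true ∷ g)  → s≤s (suc-both (loss g))
                               ; (false ∷ g) → suc-both (loss g) }
  where
    suc-both : ∀ {w x y z} → w + x ≤ y + z → w + suc x ≤ y + suc z
    suc-both {w} {x} {y} {z} le = subst₂ _≤_ (sym (+-suc w x)) (sym (+-suc y z)) (s≤s le)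

minimal-pair : ∀ {n} (L : List (Subset n)) e₀ → e₀ ∈ L →
  ∃₂ λ e f → e ∈ L × f ∈ L × (∀ g h → g ∈ L → h ∈ L → ∣ e ∩ f ∣ ≤ ∣ g ∩ h ∣)
minimal-pair L e₀ e₀∈L = e , f , e∈L , f∈L , smallest
  where
    pairs = cartesianProduct L L
    size : Subset _ × Subset _ → ℕ
    size (e , f) = ∣ e ∩ f ∣
    best = argmin size (e₀ , e₀) pairs
    e = proj₁ best
    f = proj₂ best
    best∈pairs : best ∈ pairs
    best∈pairs with argmin-sel size (e₀ , e₀) pairs
    ... | inj₁ best≡e₀e₀ = subst (_∈ pairs) (sym best≡e₀e₀) (∈-cartesianProduct⁺ e₀∈L e₀∈L)
    ... | inj₂ best∈     = best∈
    e∈L = proj₁ (∈-cartesianProduct⁻ L L best∈pairs)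
    f∈L = proj₂ (∈-cartesianProduct⁻ L L best∈pairs)
    smallest : ∀ g h → g ∈ L → h ∈ L → ∣ e ∩ f ∣ ≤ ∣ g ∩ h ∣
    smallest g h g∈L h∈L = All.lookup (f[argmin]≤f[xs] (e₀ , e₀) pairs) (∈-cartesianProduct⁺ g∈L h∈L)

double≤⇒≤ : ∀ a b → a + a ≤ suc (b + b) → a ≤ b
double≤⇒≤ zero    b       _  = z≤n
double≤⇒≤ (suc a) zero    (s≤s a+1+a≤0) rewrite +-suc a a with () ← a+1+a≤0
double≤⇒≤ (suc a) (suc b) (s≤s le) rewrite +-suc a a | +-suc b b = s≤s (double≤⇒≤ a b (s≤s⁻¹ le))

halving : ∀ {c r} → c ≤ r → let D = (r ∸ c) / 2 in D + D + c ≤ r × r ≤ suc (D + D + c)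
halving {c} {r} c≤r = lower , upper
  where
    y = r ∸ c
    twice : y / 2 * 2 ≡ y / 2 + y / 2
    twice = trans (*-comm (y / 2) 2) (cong (y / 2 +_) (+-identityʳ (y / 2)))
    lower : y / 2 + y / 2 + c ≤ r
    lower = subst (_≤ r) (cong (_+ c) twice) (subst (y / 2 * 2 + c ≤_) (m∸n+n≡m c≤r) (+-monoˡ-≤ c (m/n*n≤m y 2)))
    upper : r ≤ suc (y / 2 + y / 2 + c)
    upper = begin
        r                         ≡⟨ m∸n+n≡m c≤r ⟨
        y + c                     ≡⟨ cong (_+ c) (m≡m%n+[m/n]*n y 2) ⟩
        y % 2 + y / 2 * 2 + c     ≤⟨ +-monoˡ-≤ c (+-mono-≤ (s≤s⁻¹ (m%n<n y 2)) (≤-reflexive twice)) ⟩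
        suc (y / 2 + y / 2 + c)   ∎
      where open ≤-Reasoning

-- The trimmed core fits inside the minimal intersection.
core-fits : ∀ {D s c r} → D + D + c ≤ r → r + (s + s) ≤ c + c + c → D + s ≤ c
core-fits {D} {s} {c} {r} 2D+c≤r r+2s≤3c = double≤⇒≤ (D + s) c (≤-trans (+-cancelʳ-≤ c _ _ (begin
    (D + s) + (D + s) + c  ≡⟨ regroup D s c ⟩
    (D + D + c) + (s + s)  ≤⟨ +-monoˡ-≤ (s + s) 2D+c≤r ⟩
    r + (s + s)            ≤⟨ r+2s≤3c ⟩
    c + c + c              ∎)) (n≤1+n (c + c)))
  where
    open ≤-Reasoning
    regroup : ∀ D s c → (D + s) + (D + s) + c ≡ (D + D + c) + (s + s)
    regroup = solve-∀

-- An edge meeting the triple intersection in x vertices keeps y ≥ s vertices of the core.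
core-covers : ∀ {D s c r x y} → r ≤ suc (D + D + c) → c + c + c ≤ (x + x) + r → x + (D + s) ≤ y + c → s ≤ y
core-covers {D} {s} {c} {r} {x} {y} r≤2D+c+1 3c≤2x+r share =
  double≤⇒≤ s y (+-cancelˡ-≤ ((D + D) + (x + x) + (c + c + c)) _ _ (begin
    (D + D) + (x + x) + (c + c + c) + (s + s)        ≡⟨ regroupˡ D s c x ⟩
    (x + (D + s)) + (x + (D + s)) + (c + c + c)      ≤⟨ +-mono-≤ (+-mono-≤ share share) 3c≤2x+r ⟩
    (y + c) + (y + c) + ((x + x) + r)                ≤⟨ +-monoʳ-≤ ((y + c) + (y + c)) (+-monoʳ-≤ (x + x) r≤2D+c+1) ⟩
    (y + c) + (y + c) + ((x + x) + suc (D + D + c))  ≡⟨ regroupʳ D c x y ⟩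
    (D + D) + (x + x) + (c + c + c) + suc (y + y)    ∎))
  where
    open ≤-Reasoning
    regroupˡ : ∀ D s c x → (D + D) + (x + x) + (c + c + c) + (s + s) ≡ (x + (D + s)) + (x + (D + s)) + (c + c + c)
    regroupˡ = solve-∀
    regroupʳ : ∀ D c x y → (y + c) + (y + c) + ((x + x) + suc (D + D + c)) ≡ (D + D) + (x + x) + (c + c + c) + suc (y + y)
    regroupʳ = solve-∀

budget : ∀ {s t r c} → s ≤ t → r ≤ 3 * t ∸ 2 * s → t ≤ c → r + (s + s) ≤ c + c + c
budget {s} {t} {r} {c} s≤t r≤3t-2s t≤c = begin
    r + (s + s)        ≡⟨ cong (λ k → r + (s + k)) (+-identityʳ s) ⟨
    r + 2 * s          ≤⟨ +-monoˡ-≤ (2 * s) r≤3t-2s ⟩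
    3 * t ∸ 2 * s + 2 * s ≡⟨ m∸n+n≡m (≤-trans (*-monoʳ-≤ 2 s≤t) (*-monoˡ-≤ t (n≤1+n 2))) ⟩
    3 * t              ≤⟨ *-monoʳ-≤ 3 t≤c ⟩
    3 * c              ≡⟨ cong (c +_) (cong (c +_) (+-identityʳ c)) ⟩
    c + (c + c)        ≡⟨ +-assoc c c c ⟨
    c + c + c          ∎
  where open ≤-Reasoning

cover-in-minimal-pair : ∀ s t r → s ≤ t → r ≤ 3 * t ∸ 2 * s → (H : Hypergraph) → RTGraph r t H →
  (∃₂ λ e f → e ∈ edges H × f ∈ edges H × (∀ g h → g ∈ edges H → h ∈ edges H → ∣ e ∩ f ∣ ≤ ∣ g ∩ h ∣)) →
  ∃ λ B → IsCover s H B × ∣ B ∣ ≤ (r ∸ t) / 2 + s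
cover-in-minimal-pair s t r s≤t r≤3t-2s H (uniform , (part , transversal) , intersecting)
                      (e , f , e∈ , f∈ , smallest) = B , covers , size
  where
    c = ∣ e ∩ f ∣
    t≤c : t ≤ c
    t≤c = intersecting e f e∈ f∈
    c≤r : c ≤ r
    c≤r = subst (c ≤_) (uniform e e∈) (∣p∩q∣≤∣p∣ e f)
    D = (r ∸ c) / 2
    core = shrink (e ∩ f) (D + s) (core-fits {D = D} {s = s} (proj₁ (halving c≤r)) (budget s≤t r≤3t-2s t≤c))
    B = proj₁ core
    covers : IsCover s H B
    covers g g∈ = core-covers {D = D} {s = s} {x = ∣ (e ∩ f) ∩ g ∣} (proj₂ (halving c≤r)) three (proj₂ (proj₂ core) g)
      where
        three : c + c + c ≤ (∣ (e ∩ f) ∩ g ∣ + ∣ (e ∩ f) ∩ g ∣) + r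
        three = ≤-trans (+-mono-≤ (+-monoʳ-≤ c (smallest e g e∈ g∈)) (smallest f g f∈ g∈))
                        (three-transversals part e f g (transversal e e∈) (transversal f f∈) (transversal g g∈))
    size : ∣ B ∣ ≤ (r ∸ t) / 2 + s
    size = subst (_≤ (r ∸ t) / 2 + s) (sym (proj₁ (proj₂ core))) (+-monoˡ-≤ s (/-monoˡ-≤ 2 (∸-monoʳ-≤ r t≤c)))

-- Upper bound: every (r,t)-graph with r ≤ 3t - 2s has an s-cover of at most ⌊(r-t)/2⌋ + s vertices
-- (the empty set if there are no edges, otherwise part of a smallest pairwise intersection).
cover-upper-bound : ∀ s t r → s ≤ t → r ≤ 3 * t ∸ 2 * s → (H : Hypergraph) → RTGraph r t H →
  ∃ λ B → IsCover s H B × ∣ B ∣ ≤ (r ∸ t) / 2 + s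
cover-upper-bound s t r s≤t r≤3t-2s (hypergraph n []) _ =
  ⊥ , (λ _ ()) , subst (_≤ (r ∸ t) / 2 + s) (sym (∣⊥∣≡0 n)) z≤n
cover-upper-bound s t r s≤t r≤3t-2s H@(hypergraph n (e₀ ∷ L)) rt =
  cover-in-minimal-pair s t r s≤t r≤3t-2s H rt (minimal-pair (e₀ ∷ L) e₀ (here refl))

fails-somewhere : ∀ {q} (h : Fin q → Bool) → count h < q → ∃ λ a → h a ≡ false
fails-somewhere {suc q} h few with h zero in h0
... | false = zero , h0
... | true  with a , ha ← fails-somewhere (λ a → h (suc a)) (s≤s⁻¹ few) = suc a , ha

switch-off : ∀ {r} k (z : Fin r → Bool) →
  Σ (Fin r → Bool) λ S → count S ≤ k × count (λ i → z i ∧ not (S i)) ≤ count z ∸ k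
switch-off {zero}  k z = (λ ()) , z≤n , z≤n
switch-off {suc r} k z with z zero
switch-off {suc r} zero z | true with S , S≤0 , rest ← switch-off zero (λ i → z (suc i)) =
  (λ { zero → false ; (suc i) → S i }) , S≤0 , s≤s rest
switch-off {suc r} (suc k) z | true with S , S≤k , rest ← switch-off k (λ i → z (suc i)) =
  (λ { zero → true ; (suc i) → S i }) , s≤s S≤k , rest
switch-off {suc r} k z | false with S , S≤k , rest ← switch-off k (λ i → z (suc i)) =
  (λ { zero → false ; (suc i) → S i }) , S≤k , rest

+≤-of-positive-gap : ∀ {s d X} → 1 ≤ s → s ≤ X ∸ d → d + s ≤ X
+≤-of-positive-gap {s} {d} {X} 1≤s s≤X∸d = subst (_≤ X) (+-comm s d) (m≤o∸n⇒m+n≤o s d≤X s≤X∸d)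
  where
    d≤X : d ≤ X
    d≤X = <⇒≤ (m∸n≢0⇒n<m (λ X∸d≡0 → <-irrefl refl (≤-trans 1≤s (subst (s ≤_) X∸d≡0 s≤X∸d))))

count-below : ∀ r q → q ≤ r → count {r} (λ i → toℕ i <ᵇ q) ≡ q
count-below zero    zero    z≤n       = refl
count-below (suc r) zero    _         = sum-replicate-zero (suc r)
count-below (suc r) (suc q) (s≤s q≤r) = cong suc (count-below r q q≤r)

-- The extremal (r,t)-graph for parameters d and s, with q = d + s.  Its vertices are the
-- pairs (i , a) of a row i ∈ Fin r and a value a ∈ Fin (1 + q), encoded as  combine i a,
-- and row i is the i-th class.  The edges are the graphs {(i , x i)} of the vectors x
-- with at most d nonzero entries.
module Construction (r d s : ℕ) where

  q m : ℕ
  q = d + s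
  m = suc q

  vertex : Fin r → Fin m → Fin (r * m)
  vertex = combine

  row : Fin (r * m) → Fin r
  row = quotient m

  value : Fin (r * m) → Fin m
  value = remainder {r} m

  row-vertex : ∀ i a → row (vertex i a) ≡ i
  row-vertex i a = cong proj₁ (remQuot-combine i a)

  value-vertex : ∀ i a → value (vertex i a) ≡ a
  value-vertex i a = cong proj₂ (remQuot-combine i a)

  graph : Vec (Fin m) r → Subset (r * m)
  graph x = tabulate (λ v → ⌊ lookup x (row v) ≟ value v ⌋)

  lookup-graph : ∀ x i a → lookup (graph x) (vertex i a) ≡ ⌊ lookup x i ≟ a ⌋
  lookup-graph x i a rewrite lookup∘tabulate (λ v → ⌊ lookup x (row v) ≟ value v ⌋) (vertex i a)
    | row-vertex i a | value-vertex i a = refl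

  ∣graph∩∣ : ∀ x (Y : Subset (r * m)) → ∣ graph x ∩ Y ∣ ≡ sum (λ i → 𝟙 (lookup Y (vertex i (lookup x i))))
  ∣graph∩∣ x Y = begin
      ∣ graph x ∩ Y ∣
    ≡⟨ ∣∩∣≡count (graph x) Y ⟩
      count (λ v → lookup (graph x) v ∧ lookup Y v)
    ≡⟨ ∑-combine r m (λ v → 𝟙 (lookup (graph x) v ∧ lookup Y v)) ⟩
      sum (λ i → sum (λ a → 𝟙 (lookup (graph x) (vertex i a) ∧ lookup Y (vertex i a))))
    ≡⟨ sum-cong-≗ (λ i → ∑-single _ (lookup x i) (off-point i)) ⟩
      sum (λ i → 𝟙 (lookup (graph x) (vertex i (lookup x i)) ∧ lookup Y (vertex i (lookup x i))))
    ≡⟨ sum-cong-≗ on-point ⟩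
      sum (λ i → 𝟙 (lookup Y (vertex i (lookup x i)))) ∎
    where
      open ≡-Reasoning
      off-point : ∀ i a → a ≢ lookup x i → 𝟙 (lookup (graph x) (vertex i a) ∧ lookup Y (vertex i a)) ≡ 0
      off-point i a a≢xi rewrite lookup-graph x i a | ≟-≢ (λ xi≡a → a≢xi (sym xi≡a)) = refl
      on-point : ∀ i → 𝟙 (lookup (graph x) (vertex i (lookup x i)) ∧ lookup Y (vertex i (lookup x i)))
                     ≡ 𝟙 (lookup Y (vertex i (lookup x i)))
      on-point i rewrite lookup-graph x i (lookup x i) | ≟-refl (lookup x i) = refl

  graph-transversal : ∀ x → Transversal row (graph x)
  graph-transversal x j = begin
      ∣ graph x ∩ class row j ∣
    ≡⟨ ∣graph∩∣ x (class row j) ⟩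
      sum (λ i → 𝟙 (lookup (class row j) (vertex i (lookup x i))))
    ≡⟨ sum-cong-≗ (λ i → cong 𝟙 (trans (lookup-class row j _) (cong (λ k → ⌊ k ≟ j ⌋) (row-vertex i _)))) ⟩
      sum (λ i → 𝟙 ⌊ i ≟ j ⌋)
    ≡⟨ ∑-single _ j (λ i i≢j → cong 𝟙 (≟-≢ i≢j)) ⟩
      𝟙 ⌊ j ≟ j ⌋
    ≡⟨ cong 𝟙 (≟-refl j) ⟩
      1 ∎
    where open ≡-Reasoning

  nonzero : Fin m → Bool
  nonzero zero    = false
  nonzero (suc _) = true

  weight : Vec (Fin m) r → ℕ
  weight x = count (λ i → nonzero (lookup x i))

  agree-or-nonzero : ∀ (a b : Fin m) → 1 ≤ 𝟙 ⌊ b ≟ a ⌋ + 𝟙 (nonzero a) + 𝟙 (nonzero b)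
  agree-or-nonzero zero    zero    = s≤s z≤n
  agree-or-nonzero zero    (suc b) = m≤n+m 1 0
  agree-or-nonzero (suc a) b       = ≤-trans (m≤n+m 1 (𝟙 ⌊ b ≟ suc a ⌋)) (m≤m+n _ (𝟙 (nonzero b)))

  graph-intersection : ∀ {t} → t + (d + d) ≤ r → ∀ x y → weight x ≤ d → weight y ≤ d → t ≤ ∣ graph x ∩ graph y ∣
  graph-intersection {t} t+2d≤r x y wx≤d wy≤d = +-cancelʳ-≤ (d + d) t _ (begin
      t + (d + d)
    ≤⟨ t+2d≤r ⟩
      r
    ≡⟨ ∑-ones r ⟨
      sum {r} (λ _ → 1)
    ≤⟨ ∑-mono-≤ (λ i → agree-or-nonzero (lookup x i) (lookup y i)) ⟩
      sum (λ i → Agree i + 𝟙 (nonzero (lookup x i)) + 𝟙 (nonzero (lookup y i)))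
    ≡⟨ ∑-distrib-+₃ Agree (λ i → 𝟙 (nonzero (lookup x i))) (λ i → 𝟙 (nonzero (lookup y i))) ⟩
      sum Agree + weight x + weight y
    ≡⟨ +-assoc (sum Agree) (weight x) (weight y) ⟩
      sum Agree + (weight x + weight y)
    ≤⟨ +-monoʳ-≤ (sum Agree) (+-mono-≤ wx≤d wy≤d) ⟩
      sum Agree + (d + d)
    ≡⟨ cong (_+ (d + d)) agreements ⟨
      ∣ graph x ∩ graph y ∣ + (d + d) ∎)
    where
      open ≤-Reasoning
      Agree : Fin r → ℕ
      Agree i = 𝟙 ⌊ lookup y i ≟ lookup x i ⌋
      agreements : ∣ graph x ∩ graph y ∣ ≡ sum Agree
      agreements = trans (∣graph∩∣ x (graph y)) (sum-cong-≗ (λ i → cong 𝟙 (lookup-graph y i (lookup x i))))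

  vectors : ∀ k → List (Vec (Fin m) k)
  vectors zero    = [] ∷ []
  vectors (suc k) = cartesianProductWith _∷_ (allFin m) (vectors k)

  ∈-vectors : ∀ {k} (x : Vec (Fin m) k) → x ∈ vectors k
  ∈-vectors []      = here refl
  ∈-vectors (a ∷ x) = ∈-cartesianProductWith⁺ _∷_ (∈-allFin a) (∈-vectors x)

  light? : ∀ x → Dec (weight x ≤ d)
  light? x = weight x ≤? d

  H : Hypergraph
  H = hypergraph (r * m) (map graph (filter light? (vectors r)))

  edge⁺ : ∀ x → weight x ≤ d → graph x ∈ edges H
  edge⁺ x light = ∈-map⁺ graph (∈-filter⁺ light? (∈-vectors x) light)

  edge⁻ : ∀ e → e ∈ edges H → ∃ λ x → weight x ≤ d × e ≡ graph x
  edge⁻ e e∈ with x , x∈ , refl ← ∈-map⁻ graph e∈ = x , proj₂ (∈-filter⁻ light? {xs = vectors r} x∈) , refl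

  is-rt-graph : ∀ {t} → t + (d + d) ≤ r → RTGraph r t H
  is-rt-graph t+2d≤r = uniform , (row , partite) , intersecting
    where
      uniform : Uniform r H
      uniform e e∈ with x , _ , refl ← edge⁻ e e∈ = transversal-size row (graph x) (graph-transversal x)
      partite : ∀ e → e ∈ edges H → Transversal row e
      partite e e∈ with x , _ , refl ← edge⁻ e e∈ = graph-transversal x
      intersecting : Intersecting _ H
      intersecting e f e∈ f∈ with x , wx≤d , refl ← edge⁻ e e∈ | y , wy≤d , refl ← edge⁻ f f∈ =
        graph-intersection t+2d≤r x y wx≤d wy≤d

  B★ : Subset (r * m)
  B★ = tabulate (λ v → not (nonzero (value v)) ∧ (toℕ (row v) <ᵇ q))

  lookup-B★ : ∀ i a → lookup B★ (vertex i a) ≡ not (nonzero a) ∧ (toℕ i <ᵇ q)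
  lookup-B★ i a rewrite lookup∘tabulate (λ v → not (nonzero (value v)) ∧ (toℕ (row v) <ᵇ q)) (vertex i a)
    | row-vertex i a | value-vertex i a = refl

  ∣B★∣ : q ≤ r → ∣ B★ ∣ ≡ q
  ∣B★∣ q≤r = begin
      ∣ B★ ∣
    ≡⟨ ∣∣≡count B★ ⟩
      count (lookup B★)
    ≡⟨ ∑-combine r m (λ v → 𝟙 (lookup B★ v)) ⟩
      sum (λ i → sum (λ a → 𝟙 (lookup B★ (vertex i a))))
    ≡⟨ sum-cong-≗ (λ i → sum-cong-≗ (λ a → cong 𝟙 (lookup-B★ i a))) ⟩
      sum {r} (λ i → sum (λ a → 𝟙 (not (nonzero a) ∧ (toℕ i <ᵇ q))))
    ≡⟨ sum-cong-≗ {r} (λ i → trans (cong (𝟙 (toℕ i <ᵇ q) +_) (sum-replicate-zero q)) (+-identityʳ _)) ⟩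
      count {r} (λ i → toℕ i <ᵇ q)
    ≡⟨ count-below r q q≤r ⟩
      q ∎
    where open ≡-Reasoning

  hit-or-nonzero : ∀ (a : Fin m) b → 𝟙 b ≤ 𝟙 (not (nonzero a) ∧ b) + 𝟙 (nonzero a)
  hit-or-nonzero zero    b     = m≤m+n (𝟙 b) 0
  hit-or-nonzero (suc a) false = z≤n
  hit-or-nonzero (suc a) true  = ≤-refl

  B★-covers : q ≤ r → IsCover s H B★
  B★-covers q≤r e e∈ with x , wx≤d , refl ← edge⁻ e e∈ = +-cancelʳ-≤ d s _ (begin
      s + d
    ≡⟨ +-comm s d ⟩
      q
    ≡⟨ count-below r q q≤r ⟨
      count {r} (λ i → toℕ i <ᵇ q)
    ≤⟨ ∑-mono-≤ (λ i → hit-or-nonzero (lookup x i) (toℕ i <ᵇ q)) ⟩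
      sum (λ i → Hit i + 𝟙 (nonzero (lookup x i)))
    ≡⟨ ∑-distrib-+ Hit (λ i → 𝟙 (nonzero (lookup x i))) ⟩
      sum Hit + weight x
    ≤⟨ +-monoʳ-≤ (sum Hit) wx≤d ⟩
      sum Hit + d
    ≡⟨ cong (_+ d) hits ⟨
      ∣ B★ ∩ graph x ∣ + d ∎)
    where
      open ≤-Reasoning
      Hit : Fin r → ℕ
      Hit i = 𝟙 (not (nonzero (lookup x i)) ∧ (toℕ i <ᵇ q))
      hits : ∣ B★ ∩ graph x ∣ ≡ sum Hit
      hits = trans (cong ∣_∣ (∩-comm B★ (graph x)))
        (trans (∣graph∩∣ x B★) (sum-cong-≗ (λ i → cong 𝟙 (lookup-B★ i (lookup x i)))))

  ∣∣-by-rows : ∀ B → ∣ B ∣ ≡ sum (λ i → sum (λ a → 𝟙 (lookup B (vertex i a))))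
  ∣∣-by-rows B = trans (∣∣≡count B) (∑-combine r m (λ v → 𝟙 (lookup B v)))

  column-zero≤ : ∀ B → count (λ i → lookup B (vertex i zero)) ≤ ∣ B ∣
  column-zero≤ B = ≤-trans (∑-mono-≤ (λ i → m≤m+n (𝟙 (lookup B (vertex i zero))) _)) (≤-reflexive (sym (∣∣-by-rows B)))

  free-value : ∀ B → ∣ B ∣ < q → ∀ i → ∃ λ a → lookup B (vertex i (suc a)) ≡ false
  free-value B ∣B∣<q i = fails-somewhere (λ a → lookup B (vertex i (suc a))) (≤-trans (s≤s row≤B) ∣B∣<q)
    where
      row≤B : count (λ a → lookup B (vertex i (suc a))) ≤ ∣ B ∣
      row≤B = ≤-trans (m≤n+m _ (𝟙 (lookup B (vertex i zero))))
        (≤-trans (term≤∑ (λ i → sum (λ a → 𝟙 (lookup B (vertex i a)))) i) (≤-reflexive (sym (∣∣-by-rows B))))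

  move : Bool → Fin q → Fin m
  move true  a = suc a
  move false _ = zero

  shift : (Fin r → Bool) → (Fin r → Fin q) → Vec (Fin m) r
  shift S a = tabulate (λ i → move (S i) (a i))

  weight-shift : ∀ S a → weight (shift S a) ≡ count S
  weight-shift S a = sum-cong-≗ (λ i → cong 𝟙 (trans (cong nonzero (lookup∘tabulate _ i)) (nonzero-move (S i) (a i))))
    where
      nonzero-move : ∀ b a → nonzero (move b a) ≡ b
      nonzero-move true  _ = refl
      nonzero-move false _ = refl

  hits-shift : ∀ B S a → (∀ i → lookup B (vertex i (suc (a i))) ≡ false) →
    ∣ B ∩ graph (shift S a) ∣ ≡ count (λ i → lookup B (vertex i zero) ∧ not (S i))
  hits-shift B S a avoid = begin
      ∣ B ∩ graph (shift S a) ∣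
    ≡⟨ cong ∣_∣ (∩-comm B (graph (shift S a))) ⟩
      ∣ graph (shift S a) ∩ B ∣
    ≡⟨ ∣graph∩∣ (shift S a) B ⟩
      sum (λ i → 𝟙 (lookup B (vertex i (lookup (shift S a) i))))
    ≡⟨ sum-cong-≗ (λ i → cong 𝟙 (trans (cong (λ v → lookup B (vertex i v)) (lookup∘tabulate _ i)) (hit (S i) i))) ⟩
      count (λ i → lookup B (vertex i zero) ∧ not (S i)) ∎
    where
      open ≡-Reasoning
      hit : ∀ b i → lookup B (vertex i (move b (a i))) ≡ lookup B (vertex i zero) ∧ not b
      hit true  i = trans (avoid i) (sym (∧-zeroʳ _))
      hit false i = sym (∧-identityʳ _)

  -- A set B with fewer than q vertices is escaped by some edge: moving up to d of the rows i
  -- with (i , 0) ∈ B to a nonzero value outside B gives an edge meeting B in at most |B| - d vertices.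
  escape : ∀ B → ∣ B ∣ < q → ∃ λ x → weight x ≤ d × ∣ B ∩ graph x ∣ ≤ ∣ B ∣ ∸ d
  escape B ∣B∣<q with S , S≤d , rest ← switch-off d (λ i → lookup B (vertex i zero)) =
    shift S a , subst (_≤ d) (sym (weight-shift S a)) S≤d , hits
    where
      a : Fin r → Fin q
      a i = proj₁ (free-value B ∣B∣<q i)
      hits : ∣ B ∩ graph (shift S a) ∣ ≤ ∣ B ∣ ∸ d
      hits = begin
          ∣ B ∩ graph (shift S a) ∣
        ≡⟨ hits-shift B S a (λ i → proj₂ (free-value B ∣B∣<q i)) ⟩
          count (λ i → lookup B (vertex i zero) ∧ not (S i))
        ≤⟨ rest ⟩
          count (λ i → lookup B (vertex i zero)) ∸ d
        ≤⟨ ∸-monoˡ-≤ d (column-zero≤ B) ⟩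
          ∣ B ∣ ∸ d ∎
        where open ≤-Reasoning

  covers-are-large : 1 ≤ s → ∀ B → IsCover s H B → q ≤ ∣ B ∣
  covers-are-large 1≤s B covers with q ≤? ∣ B ∣
  ... | yes q≤∣B∣ = q≤∣B∣
  ... | no  q≰∣B∣ with x , light , hits ← escape B (≰⇒> q≰∣B∣) =
    +≤-of-positive-gap 1≤s (≤-trans (covers (graph x) (edge⁺ x light)) hits)

  cover-number : 1 ≤ s → q ≤ r → CoverNumber s H q
  cover-number 1≤s q≤r = (B★ , B★-covers q≤r , ∣B★∣ q≤r) , covers-are-large 1≤s

proposition3p10 : (s t r : ℕ) → 1 ≤ s → s ≤ t → t ≤ r → r ≤ 3 * t ∸ 2 * s →
    IsRs s r t ((r ∸ t) / 2 + s)
proposition3p10 s t r 1≤s s≤t t≤r r≤3t-2s =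
  (H , is-rt-graph t+2d≤r , cover-number 1≤s q≤r) , maximal
  where
    d = (r ∸ t) / 2
    open Construction r d s
    t+2d≤r : t + (d + d) ≤ r
    t+2d≤r = subst (_≤ r) (+-comm (d + d) t) (proj₁ (halving t≤r))
    q≤r : d + s ≤ r
    q≤r = subst (d + s ≤_) (m∸n+n≡m t≤r) (+-mono-≤ (m/n≤m (r ∸ t) 2) s≤t)
    maximal : ∀ H′ k → RTGraph r t H′ → CoverNumber s H′ k → k ≤ d + s
    maximal H′ k rt (_ , minimal) with B , covers , small ← cover-upper-bound s t r s≤t r≤3t-2s H′ rt =
      ≤-trans (minimal B covers) small
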